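{- Fix an integer $k\ge 2$. Then, as $n\to\infty$, \[ C_k(n)=O\!\left(\frac{n}{\log n}\right)\quad\text{and}\quad \sum_{d\mid kn+1}\frac{\varphi(d)}{\operatorname{ord}_k(d)}=O\!\left(\frac{n}{\log n}\right), \] i.e. there is a constant $c>0$ (depending on $k$) such that both quantities are at most $c\,n/\log n$ for all sufficiently large $n$.
   Context: $C_k(n)$ is the number of cycles (including fixed points) of the permutation of $\{1,\dots,kn\}$ given by $x\mapsto kx \bmod (kn+1)$ (residue in $\{1,\dots,kn\}$). $\varphi$ is Euler's totient function; $\operatorname{ord}_k(d)$ is the multiplicative order of $k$ modulo $d$ (with $\operatorname{ord}_k(1)=1$); $\log$ is the natural logarithm. -}

module Defs where

open import Data.Bool using (Bool; true; false; if_then_else_)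
open import Data.Nat using (ℕ; zero; suc; _+_; _*_; _∸_; _^_; _≤ᵇ_; _≡ᵇ_)
open import Data.Nat.DivMod using (_%_)
open import Data.Nat.Divisibility using (_∣?_)
open import Data.Nat.GCD using (gcd)
open import Data.List using (List; []; _∷_; map; upTo; length; filter; filterᵇ; foldr)
open import Data.Bool.ListAction using (and)
open import Data.Integer using (+_)
open import Data.Rational.Unnormalised using (ℚᵘ; mkℚᵘ; 0ℚᵘ) renaming (_+_ to _+ᵘ_)

range1 : ℕ → List ℕ
range1 m = map suc (upTo m)

-- the map x ↦ k x mod (kn+1), residue in {0,...,kn}
-- (on {1,...,kn} it takes values in {1,...,kn}, since gcd(k, kn+1) = 1)
mulMap : ℕ → ℕ → ℕ → ℕ
mulMap k n x = (k * x) % suc (k * n)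

iterate : (ℕ → ℕ) → ℕ → ℕ → ℕ
iterate f zero    x = x
iterate f (suc i) x = f (iterate f i x)

-- x is the smallest element of its cycle under mulMap k n
-- (cycle lengths are ≤ kn, so checking iterates 0..kn covers the whole cycle)
isCycleMin : ℕ → ℕ → ℕ → Bool
isCycleMin k n x = and (map (λ i → x ≤ᵇ iterate (mulMap k n) i x) (upTo (suc (k * n))))

-- C_k(n): number of cycles (fixed points included) of x ↦ kx mod (kn+1)
-- on {1,...,kn}; each cycle is counted once, via its least element.
C : ℕ → ℕ → ℕ
C k n = length (filterᵇ (isCycleMin k n) (range1 (k * n)))

φ : ℕ → ℕ
φ d = length (filterᵇ (λ a → gcd a d ≡ᵇ 1) (range1 d))

divisors : ℕ → List ℕ
divisors m = filter (_∣? m) (range1 m)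

firstWith : (ℕ → Bool) → ℕ → List ℕ → ℕ
firstWith p def []       = def
firstWith p def (x ∷ xs) = if p x then x else firstWith p def xs

-- multiplicative order of k modulo d: least m ≥ 1 with k^m ≡ 1 (mod d).
-- ord_k(1) = 1. When gcd(k,d) = 1 the order is ≤ φ(d) ≤ d, so the search
-- over 1..d finds it; the fallback value 1 (for non-coprime d, or d = 0)
-- is never used in the statement, since every d ∣ kn+1 is coprime to k.
ord : ℕ → ℕ → ℕ
ord k zero    = 1
ord k (suc e) = firstWith (λ m → ((k ^ m) % suc e) ≡ᵇ (1 % suc e)) 1 (range1 (suc e))

-- ord k d is always ≥ 1, so φ(d)/ord_k(d) is the rational with
-- numerator φ d and denominator ord k d = suc (ord k d ∸ 1)
term : ℕ → ℕ → ℚᵘ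
term k d = mkℚᵘ (+ φ d) (ord k d ∸ 1)

divSum : ℕ → ℕ → ℚᵘ
divSum k n = foldr (λ d acc → term k d +ᵘ acc) 0ℚᵘ (divisors (suc (k * n)))

ℕ→ℚᵘ : ℕ → ℚᵘ
ℕ→ℚᵘ m = mkℚᵘ (+ m) 0

module Submission where

-- Write M = kn + 1 and take L = ⌊⌊log₂ n⌋ / 3k⌋, so that ⌊log₂ n⌋ ≤ 3k(L + 1) and (L + 1)k^(2L) ≤ n.
-- A cycle of x ↦ kx of length at least L contains L distinct residues modulo M, so there are at
-- most M / L such cycles. A point x on a cycle of length m < L satisfies kᵐx ≡ x (mod M), so it is
-- determined by m and ⌊kᵐx / M⌋ < k^L; hence C_k(n) ≤ M / L + L k^L.
-- Similarly a divisor d of M with ord_k(d) > L contributes less than φ(d) / L, and Σ_{d ∣ M} φ(d) ≤ M + 1,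
-- while a divisor with ord_k(d) ≤ L divides k^ord_k(d) − 1, so d ≤ k^L: there are at most k^L + 1 of
-- these, each contributing at most φ(d) ≤ k^L. Multiplying by ⌊log₂ n⌋ ≤ 3k(L + 1) gives O(n) in both cases.

open import Defs
import Algebra.Properties.CommutativeSemigroup as CommSemigroupProperties
open import Data.Bool using (Bool; true; false; T; T?; if_then_else_)
open import Data.Bool.ListAction using (and)
open import Data.Bool.Properties using (T-∧)
open import Data.Empty using (⊥-elim)
open import Data.Fin using (toℕ; fromℕ<)
open import Data.Fin.Properties using (pigeonhole; toℕ<n; toℕ-fromℕ<)
import Data.Integer as ℤ
import Data.Integer.Properties as ℤ
open import Data.List using (List; []; _∷_; foldr; map; length; filter; filterᵇ; concatMap; upTo; applyUpTo)
open import Data.List.Membership.Propositional using (_∈_; find; lose)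
open import Data.List.Membership.Propositional.Properties
  using (∈-filter⁻; ∈-concatMap⁻; ∈-map⁺; ∈-map⁻; ∈-upTo⁺; ∈-upTo⁻; ∈-applyUpTo⁻)
open import Data.List.Properties
  using (map-cong; length-filter; length-++; length-map; length-upTo; length-applyUpTo; filter-all; filter-accept; filter-reject)
open import Data.List.Relation.Unary.All as All using (All; []; _∷_)
import Data.List.Relation.Unary.All.Properties as All
open import Data.List.Relation.Unary.Any using (Any; here; there; any?)
open import Data.List.Relation.Unary.Unique.Propositional using (Unique; []; _∷_)
import Data.List.Relation.Unary.Unique.Propositional.Properties as Unique
open import Data.Nat
  using (ℕ; zero; suc; _+_; _*_; _∸_; _^_; _≤_; _<_; z≤n; s≤s; z<s; NonZero; >-nonZero
        ; _≟_; _≤?_; _≡ᵇ_; _≤ᵇ_; ⌊_/2⌋; ⌈_/2⌉)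
open import Data.Nat.Coprimality as Coprime using (Coprime; gcd≡1⇒coprime; coprime-divisor)
open import Data.Nat.DivMod
open import Data.Nat.Divisibility using (_∣_; _∣?_; ∣-refl; ∣-antisym; n∣m*n; ∣m⇒∣m*n; ∣n⇒∣m*n)
open import Data.Nat.GCD using (gcd)
open import Data.Nat.Induction using (<-wellFounded)
open import Data.Nat.ListAction using (sum)
open import Data.Nat.Logarithm using (⌊log₂_⌋)
open import Data.Nat.Logarithm.Core using (⌊log2⌋)
open import Data.Nat.Properties
open import Data.Nat.Tactic.RingSolver using (solve-∀)
open import Data.Product using (Σ; ∃; _×_; _,_; proj₁; proj₂; map₁; map₂)
open import Data.Rational.Unnormalised
  using (ℚᵘ; mkℚᵘ; 0ℚᵘ; *≤*; *≡*) renaming (_+_ to _+ᵘ_; _*_ to _*ᵘ_; _≤_ to _≤ᵘ_; _≃_ to _≃ᵘ_)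
import Data.Rational.Unnormalised.Properties as ℚ
open import Data.Sum using (inj₁; inj₂)
open import Function using (_∘_; it)
open import Function.Bundles using (Equivalence)
open import Induction.WellFounded using (Acc; acc)
open import Relation.Binary.PropositionalEquality
open import Relation.Nullary using (¬_; ¬?; yes; no; _×-dec_)
open import Relation.Unary using (Decidable)

open CommSemigroupProperties +-commutativeSemigroup using () renaming (interchange to +-interchange; xy∙z≈xz∙y to +-xy∙z≈xz∙y)

private
  variable
    A : Set

length-≤-filter-≢ : ∀ b {xs : List ℕ} → Unique xs →
  length xs ≤ suc (length (filter (λ y → ¬? (y ≟ b)) xs))
length-≤-filter-≢ b {[]} [] = z≤n
length-≤-filter-≢ b {y ∷ ys} (y∉ys ∷ u) with y ≟ b
... | yes refl rewrite filter-reject (λ y → ¬? (y ≟ b)) {b} {ys} (λ b≢b → b≢b refl) =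
  s≤s (≤-reflexive (sym (cong length (filter-all (λ y → ¬? (y ≟ b)) (All.map (λ b≢z z≡b → b≢z (sym z≡b)) y∉ys)))))
... | no y≢b rewrite filter-accept (λ y → ¬? (y ≟ b)) {y} {ys} y≢b = s≤s (length-≤-filter-≢ b u)

Unique-bounded⇒length≤ : ∀ B {xs : List ℕ} → Unique xs → All (_< B) xs → length xs ≤ B
Unique-bounded⇒length≤ zero [] [] = z≤n
Unique-bounded⇒length≤ (suc B) {xs} u bounded =
  ≤-trans (length-≤-filter-≢ B u)
    (s≤s (Unique-bounded⇒length≤ B (Unique.filter⁺ _ u) (All.tabulate below)))
  where
  below : ∀ {y} → y ∈ filter (λ y → ¬? (y ≟ B)) xs → y < B
  below y∈ with y∈xs , y≢B ← ∈-filter⁻ (λ y → ¬? (y ≟ B)) y∈ = ≤∧≢⇒< (≤-pred (All.lookup bounded y∈xs)) y≢B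

Unique-map⁺-on : (f : A → ℕ) {xs : List A} →
  (∀ {a b} → a ∈ xs → b ∈ xs → f a ≡ f b → a ≡ b) → Unique xs → Unique (map f xs)
Unique-map⁺-on f inj [] = []
Unique-map⁺-on f inj (x∉xs ∷ u) =
  All.map⁺ (All.tabulate λ y∈xs fx≡fy → All.lookup x∉xs y∈xs (inj (here refl) (there y∈xs) fx≡fy))
  ∷ Unique-map⁺-on f (λ a∈ b∈ → inj (there a∈) (there b∈)) u

injection-bounded⇒length≤ : ∀ B (f : A → ℕ) {xs : List A} → Unique xs →
  (∀ {a b} → a ∈ xs → b ∈ xs → f a ≡ f b → a ≡ b) → (∀ {a} → a ∈ xs → f a < B) →
  length xs ≤ B
injection-bounded⇒length≤ B f {xs} u inj bounded =
  subst (_≤ B) (length-map f xs)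
    (Unique-bounded⇒length≤ B (Unique-map⁺-on f inj u) (All.map⁺ (All.tabulate bounded)))

length-concatMap : (f : A → List ℕ) (xs : List A) → length (concatMap f xs) ≡ sum (map (length ∘ f) xs)
length-concatMap f [] = refl
length-concatMap f (x ∷ xs) = trans (length-++ (f x)) (cong (length (f x) +_) (length-concatMap f xs))

Unique-concatMap⁺ : (f : A → List ℕ) {xs : List A} → Unique xs →
  (∀ {x} → x ∈ xs → Unique (f x)) →
  (∀ {x y v} → x ∈ xs → y ∈ xs → v ∈ f x → v ∈ f y → x ≡ y) →
  Unique (concatMap f xs)
Unique-concatMap⁺ f [] _ _ = []
Unique-concatMap⁺ f {x ∷ xs} (x∉xs ∷ u) unique disjoint =
  Unique.++⁺ (unique (here refl))
    (Unique-concatMap⁺ f u (unique ∘ there) (λ x∈ y∈ → disjoint (there x∈) (there y∈)))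
    λ (v∈fx , v∈rest) →
      let y , y∈xs , v∈fy = find (∈-concatMap⁻ f {xs = xs} v∈rest) in
      All.lookup x∉xs y∈xs (disjoint (here refl) (there y∈xs) v∈fx v∈fy)

disjoint-bounded⇒sum-length≤ : ∀ B (f : A → List ℕ) {xs : List A} → Unique xs →
  (∀ {x} → x ∈ xs → Unique (f x)) →
  (∀ {x y v} → x ∈ xs → y ∈ xs → v ∈ f x → v ∈ f y → x ≡ y) →
  (∀ {x v} → x ∈ xs → v ∈ f x → v < B) →
  sum (map (length ∘ f) xs) ≤ B
disjoint-bounded⇒sum-length≤ B f {xs} u unique disjoint bounded =
  subst (_≤ B) (length-concatMap f xs)
    (Unique-bounded⇒length≤ B (Unique-concatMap⁺ f u unique disjoint) (All.tabulate below))
  where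
  below : ∀ {v} → v ∈ concatMap f xs → v < B
  below v∈ with y , y∈xs , v∈fy ← find (∈-concatMap⁻ f {xs = xs} v∈) = bounded y∈xs v∈fy

length-filter-split : ∀ {P : ℕ → Set} (P? : Decidable P) xs →
  length xs ≡ length (filter (¬? ∘ P?) xs) + length (filter P? xs)
length-filter-split P? [] = refl
length-filter-split P? (x ∷ xs) with P? x
... | yes _ = trans (cong suc (length-filter-split P? xs)) (sym (+-suc _ _))
... | no _ = cong suc (length-filter-split P? xs)

sum-map-const : ∀ {g : A → ℕ} {c} xs → (∀ x → g x ≡ c) → sum (map g xs) ≡ length xs * c
sum-map-const [] _ = refl
sum-map-const (x ∷ xs) g≡c = cong₂ _+_ (g≡c x) (sum-map-const xs g≡c)

sum-map-+ : ∀ (f g : A → ℕ) xs → sum (map (λ x → f x + g x) xs) ≡ sum (map f xs) + sum (map g xs)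
sum-map-+ f g [] = refl
sum-map-+ f g (x ∷ xs) = trans (cong (f x + g x +_) (sum-map-+ f g xs)) (+-interchange (f x) (g x) _ _)

sum-map-*ˡ : ∀ c (f : A → ℕ) xs → sum (map (λ x → c * f x) xs) ≡ c * sum (map f xs)
sum-map-*ˡ c f [] = sym (*-zeroʳ c)
sum-map-*ˡ c f (x ∷ xs) = trans (cong (c * f x +_) (sum-map-*ˡ c f xs)) (sym (*-distribˡ-+ c (f x) _))

sum-map-if : ∀ (p : A → Bool) w xs → sum (map (λ x → if p x then w else 0) xs) ≡ w * length (filterᵇ p xs)
sum-map-if p w [] = sym (*-zeroʳ w)
sum-map-if p w (x ∷ xs) with p x
... | true = trans (cong (w +_) (sum-map-if p w xs)) (sym (*-suc w _))
... | false = sum-map-if p w xs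

T-and-map : ∀ (f : ℕ → Bool) {xs y} → T (and (map f xs)) → y ∈ xs → T (f y)
T-and-map f {x ∷ xs} all-f (here refl) = proj₁ (Equivalence.to T-∧ all-f)
T-and-map f {x ∷ xs} all-f (there y∈xs) = T-and-map f (proj₂ (Equivalence.to T-∧ all-f)) y∈xs

*+-injective : ∀ K .{{_ : NonZero K}} {a b c d} → b < K → d < K → a * K + b ≡ c * K + d → a ≡ c × b ≡ d
*+-injective K {a} {b} {c} {d} b<K d<K eq =
  *-cancelʳ-≡ a c K (+-cancelʳ-≡ b (a * K) (c * K) (trans eq (cong (c * K +_) (sym b≡d)))) , b≡d
  where
  b≡d : b ≡ d
  b≡d = begin
    b               ≡⟨ m<n⇒m%n≡m b<K ⟨
    b % K           ≡⟨ [m+kn]%n≡m%n b a K ⟨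
    (b + a * K) % K ≡⟨ cong (_% K) (trans (+-comm b (a * K)) (trans eq (+-comm (c * K) d))) ⟩
    (d + c * K) % K ≡⟨ [m+kn]%n≡m%n d c K ⟩
    d % K           ≡⟨ m<n⇒m%n≡m d<K ⟩
    d               ∎
    where open ≡-Reasoning

2≤m⇒2≤m^n : ∀ {m n} → 2 ≤ m → 1 ≤ n → 2 ≤ m ^ n
2≤m⇒2≤m^n {m} {n} 2≤m 1≤n = ≤-trans 2≤m (subst (_≤ m ^ n) (*-identityʳ m) (^-monoʳ-≤ m {{>-nonZero (<-trans z<s 2≤m)}} 1≤n))

a*x≡x+q⇒x-unique : ∀ {a x y q} → 2 ≤ a → a * x ≡ x + q → a * y ≡ y + q → x ≡ y
a*x≡x+q⇒x-unique {suc (suc t)} {x} {y} (s≤s (s≤s _)) ax≡x+q ay≡y+q =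
  *-cancelˡ-≡ x y (suc t) (trans (+-cancelˡ-≡ x _ _ ax≡x+q) (sym (+-cancelˡ-≡ y _ _ ay≡y+q)))

2^⌊log2⌋≤ : ∀ n (a : Acc _<_ n) → 1 ≤ n → 2 ^ ⌊log2⌋ n a ≤ n
2^⌊log2⌋≤ (suc zero) _ _ = ≤-refl
2^⌊log2⌋≤ (suc (suc m)) (acc rs) _ = begin
  2 * 2 ^ ⌊log2⌋ (suc ⌊ m /2⌋) _  ≤⟨ *-monoʳ-≤ 2 (2^⌊log2⌋≤ (suc ⌊ m /2⌋) _ (s≤s z≤n)) ⟩
  2 * suc ⌊ m /2⌋                 ≡⟨ *-suc 2 ⌊ m /2⌋ ⟩
  2 + (⌊ m /2⌋ + (⌊ m /2⌋ + 0))   ≤⟨ +-monoʳ-≤ 2 (+-monoʳ-≤ ⌊ m /2⌋ (≤-trans (≤-reflexive (+-identityʳ _)) (⌊n/2⌋≤⌈n/2⌉ m))) ⟩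
  2 + (⌊ m /2⌋ + ⌈ m /2⌉)         ≡⟨ cong (2 +_) (⌊n/2⌋+⌈n/2⌉≡n m) ⟩
  2 + m                           ∎
  where open ≤-Reasoning

2^⌊log₂n⌋≤n : ∀ n → 1 ≤ n → 2 ^ ⌊log₂ n ⌋ ≤ n
2^⌊log₂n⌋≤n n = 2^⌊log2⌋≤ n (<-wellFounded n)

n<2^n : ∀ n → n < 2 ^ n
n<2^n zero = s≤s z≤n
n<2^n (suc n) = ≤-trans (≤-reflexive (cong suc (+-comm 1 n)))
  (≤-trans (+-mono-≤ (n<2^n n) (m^n>0 2 n)) (≤-reflexive (cong (2 ^ n +_) (sym (+-identityʳ (2 ^ n))))))

1+kn+n+kn≤2[1+k]n : ∀ k n → 1 ≤ n → suc (k * n) + n + k * n ≤ 2 * (suc k * n)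
1+kn+n+kn≤2[1+k]n k (suc n) (s≤s _) = ≤-trans (m≤m+n _ n) (≤-reflexive (sym (identity k n)))
  where
  identity : ∀ k n → 2 * (suc k * suc n) ≡ suc (k * suc n) + suc n + k * suc n + n
  identity = solve-∀

2+kn+2n≤2[1+k]n : ∀ k n → 2 ≤ k → 1 ≤ n → suc (suc (k * n)) + 2 * n ≤ 2 * (suc k * n)
2+kn+2n≤2[1+k]n (suc (suc k)) (suc n) (s≤s (s≤s _)) (s≤s _) =
  ≤-trans (m≤m+n _ (2 * n + k * suc n)) (≤-reflexive (sym (identity k n)))
  where
  identity : ∀ k n → 2 * (suc (suc (suc k)) * suc n) ≡ suc (suc (suc (suc k) * suc n)) + 2 * suc n + (2 * n + k * suc n)
  identity = solve-∀

[m*[n%d]]%d≡[m*n]%d : ∀ m n d .{{_ : NonZero d}} → (m * (n % d)) % d ≡ (m * n) % d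
[m*[n%d]]%d≡[m*n]%d m n d = begin
  (m * (n % d)) % d           ≡⟨ %-distribˡ-* m (n % d) d ⟩
  ((m % d) * (n % d % d)) % d ≡⟨ cong (λ z → ((m % d) * z) % d) (m%n%n≡m%n n d) ⟩
  ((m % d) * (n % d)) % d     ≡⟨ %-distribˡ-* m n d ⟨
  (m * n) % d                 ∎
  where open ≡-Reasoning

*-congˡ-% : ∀ c {a b d} .{{_ : NonZero d}} → a % d ≡ b % d → (c * a) % d ≡ (c * b) % d
*-congˡ-% c {a} {b} {d} a≡b = begin
  (c * a) % d        ≡⟨ [m*[n%d]]%d≡[m*n]%d c a d ⟨
  (c * (a % d)) % d  ≡⟨ cong (λ z → (c * z) % d) a≡b ⟩
  (c * (b % d)) % d  ≡⟨ [m*[n%d]]%d≡[m*n]%d c b d ⟩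
  (c * b) % d        ∎
  where open ≡-Reasoning

*-congʳ-% : ∀ c {a b d} .{{_ : NonZero d}} → a % d ≡ b % d → (a * c) % d ≡ (b * c) % d
*-congʳ-% c {a} {b} a≡b = subst₂ (λ x y → x % _ ≡ y % _) (*-comm c a) (*-comm c b) (*-congˡ-% c a≡b)

%≡1⇒*-identityˡ-% : ∀ u a d .{{_ : NonZero d}} → u % d ≡ 1 % d → (u * a) % d ≡ a % d
%≡1⇒*-identityˡ-% u a d u≡1 = trans (*-congʳ-% a u≡1) (cong (_% d) (*-identityˡ a))

%≡1⇒^%≡1 : ∀ u i d .{{_ : NonZero d}} → u % d ≡ 1 % d → (u ^ i) % d ≡ 1 % d
%≡1⇒^%≡1 u zero d u≡1 = refl
%≡1⇒^%≡1 u (suc i) d u≡1 =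
  trans (*-congʳ-% (u ^ i) u≡1) (trans (cong (_% d) (*-identityˡ (u ^ i))) (%≡1⇒^%≡1 u i d u≡1))

module Invertible {k u d : ℕ} .{{_ : NonZero d}} (u*k≡1 : (u * k) % d ≡ 1 % d) where

  *-cancelˡ-% : ∀ {a b} → (k * a) % d ≡ (k * b) % d → a % d ≡ b % d
  *-cancelˡ-% {a} {b} ka≡kb = begin
    a % d            ≡⟨ %≡1⇒*-identityˡ-% (u * k) a d u*k≡1 ⟨
    (u * k * a) % d  ≡⟨ cong (_% d) (*-assoc u k a) ⟩
    (u * (k * a)) % d ≡⟨ *-congˡ-% u ka≡kb ⟩
    (u * (k * b)) % d ≡⟨ cong (_% d) (*-assoc u k b) ⟨
    (u * k * b) % d  ≡⟨ %≡1⇒*-identityˡ-% (u * k) b d u*k≡1 ⟩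
    b % d            ∎
    where open ≡-Reasoning

  ^-cancelˡ-% : ∀ i {a b} → (k ^ i * a) % d ≡ (k ^ i * b) % d → a % d ≡ b % d
  ^-cancelˡ-% zero {a} {b} eq = subst₂ (λ x y → x % d ≡ y % d) (*-identityˡ a) (*-identityˡ b) eq
  ^-cancelˡ-% (suc i) {a} {b} eq = ^-cancelˡ-% i (*-cancelˡ-%
    (subst₂ (λ x y → x % d ≡ y % d) (*-assoc k (k ^ i) a) (*-assoc k (k ^ i) b) eq))

  ^≡1-%-exists : ∃ λ p → 1 ≤ p × p ≤ d × (k ^ p) % d ≡ 1 % d
  ^≡1-%-exists with i , j , i<j , kⁱ≡kʲ ← pigeonhole (n<1+n d) (λ i → fromℕ< (m%n<n (k ^ toℕ i) d)) =
    p , m<n⇒0<n∸m i<j , ≤-trans (m∸n≤m (toℕ j) (toℕ i)) (≤-pred (toℕ<n j)) , sym (^-cancelˡ-% (toℕ i) kⁱ*1≡kⁱ*kᵖ)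
    where
    p = toℕ j ∸ toℕ i
    kⁱ*1≡kⁱ*kᵖ : (k ^ toℕ i * 1) % d ≡ (k ^ toℕ i * k ^ p) % d
    kⁱ*1≡kⁱ*kᵖ = begin
      (k ^ toℕ i * 1) % d        ≡⟨ cong (_% d) (*-identityʳ (k ^ toℕ i)) ⟩
      k ^ toℕ i % d              ≡⟨ toℕ-fromℕ< (m%n<n (k ^ toℕ i) d) ⟨
      toℕ (fromℕ< _)             ≡⟨ cong toℕ kⁱ≡kʲ ⟩
      toℕ (fromℕ< _)             ≡⟨ toℕ-fromℕ< (m%n<n (k ^ toℕ j) d) ⟩
      k ^ toℕ j % d              ≡⟨ cong (λ z → k ^ z % d) (m+[n∸m]≡n (<⇒≤ i<j)) ⟨
      k ^ (toℕ i + p) % d        ≡⟨ cong (_% d) (^-distribˡ-+-* k (toℕ i) p) ⟩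
      (k ^ toℕ i * k ^ p) % d    ∎
      where open ≡-Reasoning

-- k · kn² = (kn)², and kn ≡ −1 modulo kn + 1.
[k*n*n]*k≡1-mod-divisor : ∀ k n d .{{_ : NonZero d}} → d ∣ suc (k * n) → (k * n * n * k) % d ≡ 1 % d
[k*n*n]*k≡1-mod-divisor k n d d∣M = begin
  (k * n * n * k) % d           ≡⟨ %-remove-+ʳ (k * n * n * k) (∣n⇒∣m*n 2 d∣M) ⟨
  (k * n * n * k + 2 * M) % d   ≡⟨ cong (_% d) (identity k n) ⟩
  (1 + M * M) % d               ≡⟨ %-remove-+ʳ 1 (∣m⇒∣m*n M d∣M) ⟩
  1 % d                         ∎
  where
  open ≡-Reasoning
  M = suc (k * n)
  identity : ∀ k n → k * n * n * k + 2 * suc (k * n) ≡ 1 + suc (k * n) * suc (k * n)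
  identity = solve-∀

%≡1⇒≤ : ∀ {a d} .{{_ : NonZero d}} → 2 ≤ a → a % d ≡ 1 % d → d ≤ a
%≡1⇒≤ {a} {d} 2≤a a≡1 = m/n≢0⇒n≤m λ a/d≡0 →
  ≤⇒≯ (subst (_≤ 1) (trans (sym a≡1) (m<n⇒m%n≡m (m/n≡0⇒m<n a/d≡0))) (m%n≤m 1 d)) 2≤a

firstWith-satisfies : ∀ (p : ℕ → Bool) def {xs x} → x ∈ xs → T (p x) →
  T (p (firstWith p def xs)) × firstWith p def xs ∈ xs
firstWith-satisfies p def {y ∷ ys} x∈xs px with p y in py
... | true = subst T (sym py) _ , here refl
firstWith-satisfies p def {y ∷ ys} (here refl) px | false = ⊥-elim (subst T py px)
firstWith-satisfies p def {y ∷ ys} (there x∈ys) px | false =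
  map₂ there (firstWith-satisfies p def x∈ys px)

∈-range1⁺ : ∀ {m x} → 1 ≤ x → x ≤ m → x ∈ range1 m
∈-range1⁺ {x = suc x} _ x≤m = ∈-map⁺ suc (∈-upTo⁺ x≤m)

∈-range1⁻ : ∀ {m x} → x ∈ range1 m → 1 ≤ x × x ≤ m
∈-range1⁻ x∈ with i , i∈ , refl ← ∈-map⁻ suc x∈ = s≤s z≤n , ∈-upTo⁻ i∈

length-range1 : ∀ m → length (range1 m) ≡ m
length-range1 m = trans (length-map suc (upTo m)) (length-upTo m)

Unique-range1 : ∀ m → Unique (range1 m)
Unique-range1 m = Unique.map⁺ suc-injective (Unique.upTo⁺ m)

ord-spec : ∀ {k u d} .{{_ : NonZero d}} → (u * k) % d ≡ 1 % d →
  1 ≤ ord k d × (k ^ ord k d) % d ≡ 1 % d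
ord-spec {k} {u} {d = suc e} u*k≡1
  with p , 1≤p , p≤d , kᵖ≡1 ← Invertible.^≡1-%-exists {k} {u} u*k≡1
  with sat , o∈ ← firstWith-satisfies (λ m → (k ^ m % suc e) ≡ᵇ (1 % suc e)) 1 (∈-range1⁺ 1≤p p≤d) (≡⇒≡ᵇ _ _ kᵖ≡1)
  = proj₁ (∈-range1⁻ o∈) , ≡ᵇ⇒≡ _ _ sat

-- Cycles of x ↦ kx mod (kn + 1)

module Orbits (k n : ℕ) where

  M : ℕ
  M = suc (k * n)

  orbit : ℕ → ℕ → ℕ
  orbit i x = (k ^ i * x) % M

  orbit-zero : ∀ {x} → x < M → orbit 0 x ≡ x
  orbit-zero {x} x<M = trans (cong (_% M) (*-identityˡ x)) (m<n⇒m%n≡m x<M)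

  orbit-+ : ∀ i j x → orbit i (orbit j x) ≡ orbit (i + j) x
  orbit-+ i j x = begin
    (k ^ i * ((k ^ j * x) % M)) % M ≡⟨ [m*[n%d]]%d≡[m*n]%d (k ^ i) (k ^ j * x) M ⟩
    (k ^ i * (k ^ j * x)) % M       ≡⟨ cong (_% M) (*-assoc (k ^ i) (k ^ j) x) ⟨
    (k ^ i * k ^ j * x) % M         ≡⟨ cong (λ z → (z * x) % M) (^-distribˡ-+-* k i j) ⟨
    (k ^ (i + j) * x) % M           ∎
    where open ≡-Reasoning

  iterate-mulMap : ∀ i {x} → x < M → iterate (mulMap k n) i x ≡ orbit i x
  iterate-mulMap zero x<M = sym (orbit-zero x<M)
  iterate-mulMap (suc i) {x} x<M = begin
    (k * iterate (mulMap k n) i x) % M ≡⟨ cong (λ z → (k * z) % M) (iterate-mulMap i x<M) ⟩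
    (k * ((k ^ i * x) % M)) % M        ≡⟨ [m*[n%d]]%d≡[m*n]%d k (k ^ i * x) M ⟩
    (k * (k ^ i * x)) % M              ≡⟨ cong (_% M) (*-assoc k (k ^ i) x) ⟨
    (k ^ suc i * x) % M                ∎
    where open ≡-Reasoning

  k⁻¹ : (k * n * n * k) % M ≡ 1 % M
  k⁻¹ = [k*n*n]*k≡1-mod-divisor k n M ∣-refl

  open Invertible {k} {k * n * n} {M} k⁻¹

  orbit-cancel : ∀ {i j x y} → i ≤ j → x < M → orbit i x ≡ orbit j y → x ≡ orbit (j ∸ i) y
  orbit-cancel {i} {j} {x} {y} i≤j x<M eq = begin
    x                         ≡⟨ m<n⇒m%n≡m x<M ⟨
    x % M                     ≡⟨ ^-cancelˡ-% i (trans eq (sym orbit-split)) ⟩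
    orbit (j ∸ i) y % M       ≡⟨ m%n%n≡m%n (k ^ (j ∸ i) * y) M ⟩
    orbit (j ∸ i) y           ∎
    where
    open ≡-Reasoning
    orbit-split : orbit i (orbit (j ∸ i) y) ≡ orbit j y
    orbit-split = trans (orbit-+ i (j ∸ i) y) (cong (λ z → orbit z y) (m+[n∸m]≡n i≤j))

  -- Going backwards along an orbit: with p the order of k modulo M, s = (p − 1) r mod p undoes r steps.
  orbit-back : ∀ r {x y} → y < M → orbit r y ≡ x → ∃ λ s → s ≤ k * n × orbit s x ≡ y
  orbit-back r {x} {y} y<M orbit-r-y≡x
    with suc p-1 , _ , p≤M , kᵖ≡1 ← ^≡1-%-exists = s , ≤-pred (≤-trans (m%n<n (p-1 * r) p) p≤M) , s-steps-back
    where
    p = suc p-1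
    s = (p-1 * r) % p
    q = (p-1 * r) / p
    periodic : ∀ i t → orbit (i + t * p) y ≡ orbit i y
    periodic i t = begin
      (k ^ (i + t * p) * y) % M     ≡⟨ cong (λ z → (z * y) % M) (^-distribˡ-+-* k i (t * p)) ⟩
      (k ^ i * k ^ (t * p) * y) % M ≡⟨ cong (λ z → (z * y) % M) (*-comm (k ^ i) (k ^ (t * p))) ⟩
      (k ^ (t * p) * k ^ i * y) % M ≡⟨ cong (_% M) (*-assoc (k ^ (t * p)) (k ^ i) y) ⟩
      (k ^ (t * p) * (k ^ i * y)) % M ≡⟨ %≡1⇒*-identityˡ-% (k ^ (t * p)) (k ^ i * y) M kᵗᵖ≡1 ⟩
      (k ^ i * y) % M               ∎
      where
      open ≡-Reasoning
      kᵗᵖ≡1 : k ^ (t * p) % M ≡ 1 % M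
      kᵗᵖ≡1 = subst (λ z → z % M ≡ 1 % M) (trans (^-*-assoc k p t) (cong (k ^_) (*-comm p t))) (%≡1⇒^%≡1 (k ^ p) t M kᵖ≡1)
    s-steps-back : orbit s x ≡ y
    s-steps-back = begin
      orbit s x                   ≡⟨ cong (orbit s) orbit-r-y≡x ⟨
      orbit s (orbit r y)         ≡⟨ orbit-+ s r y ⟩
      orbit (s + r) y             ≡⟨ periodic (s + r) q ⟨
      orbit (s + r + q * p) y     ≡⟨ cong (λ z → orbit z y) (+-xy∙z≈xz∙y s r (q * p)) ⟩
      orbit ((s + q * p) + r) y   ≡⟨ cong (λ z → orbit (z + r) y) (m≡m%n+[m/n]*n (p-1 * r) p) ⟨
      orbit (p-1 * r + r) y       ≡⟨ cong (λ z → orbit z y) (trans (+-comm (p-1 * r) r) (*-comm p r)) ⟩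
      orbit (0 + r * p) y         ≡⟨ periodic 0 r ⟩
      orbit 0 y                   ≡⟨ orbit-zero y<M ⟩
      y                           ∎
      where open ≡-Reasoning

  CycleMin : ℕ → Set
  CycleMin x = T (isCycleMin k n x)

  cycleMin-≤-orbit : ∀ {x s} → CycleMin x → x < M → s ≤ k * n → x ≤ orbit s x
  cycleMin-≤-orbit {x} {s} min x<M s≤kn = subst (x ≤_) (iterate-mulMap s x<M)
    (≤ᵇ⇒≤ x _ (T-and-map (λ i → x ≤ᵇ iterate (mulMap k n) i x) min (∈-upTo⁺ (s≤s s≤kn))))

  cycleMin-unique : ∀ t {x y} → CycleMin x → CycleMin y → x < M → y < M → orbit t y ≡ x → x ≡ y
  cycleMin-unique t {x} {y} min-x min-y x<M y<M orbit-t-y≡x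
    with s , s≤kn , orbit-s-x≡y ← orbit-back t y<M orbit-t-y≡x
    with s′ , s′≤kn , orbit-s′-y≡x ← orbit-back s x<M orbit-s-x≡y
    = ≤-antisym (subst (x ≤_) orbit-s-x≡y (cycleMin-≤-orbit min-x x<M s≤kn))
                (subst (y ≤_) orbit-s′-y≡x (cycleMin-≤-orbit min-y y<M s′≤kn))

  cycleMins : List ℕ
  cycleMins = filterᵇ (isCycleMin k n) (range1 (k * n))

  Unique-cycleMins : Unique cycleMins
  Unique-cycleMins = Unique.filter⁺ (T? ∘ isCycleMin k n) (Unique-range1 (k * n))

  ∈-cycleMins⁻ : ∀ {x} → x ∈ cycleMins → CycleMin x × x < M
  ∈-cycleMins⁻ x∈ with x∈range , min ← ∈-filter⁻ (T? ∘ isCycleMin k n) x∈ = min , s≤s (proj₂ (∈-range1⁻ x∈range))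

  module _ (L : ℕ) where

    ShortPeriod : ℕ → Set
    ShortPeriod x = Any (λ m → 1 ≤ m × orbit m x ≡ x) (upTo L)

    shortPeriod? : Decidable ShortPeriod
    shortPeriod? x = any? (λ m → (1 ≤? m) ×-dec (orbit m x ≟ x)) (upTo L)

    orbitSegment : ℕ → List ℕ
    orbitSegment x = applyUpTo (λ i → orbit i x) L

    Unique-orbitSegment : ∀ {x} → x < M → ¬ ShortPeriod x → Unique (orbitSegment x)
    Unique-orbitSegment {x} x<M aperiodic = Unique.applyUpTo⁺₁ _ L λ {i} {j} i<j j<L orbit-i≡orbit-j →
      aperiodic (lose (∈-upTo⁺ (≤-<-trans (m∸n≤m j i) j<L))
                      (m<n⇒0<n∸m i<j , sym (orbit-cancel (<⇒≤ i<j) x<M orbit-i≡orbit-j)))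

    orbitSegments-disjoint : ∀ {x y v} → x ∈ cycleMins → y ∈ cycleMins →
      v ∈ orbitSegment x → v ∈ orbitSegment y → x ≡ y
    orbitSegments-disjoint x∈ y∈ v∈x v∈y
      with min-x , x<M ← ∈-cycleMins⁻ x∈ | min-y , y<M ← ∈-cycleMins⁻ y∈
      with i , _ , refl ← ∈-applyUpTo⁻ _ v∈x | j , _ , v≡orbit-j-y ← ∈-applyUpTo⁻ _ v∈y
      with ≤-total i j
    ... | inj₁ i≤j = cycleMin-unique (j ∸ i) min-x min-y x<M y<M (sym (orbit-cancel i≤j x<M v≡orbit-j-y))
    ... | inj₂ j≤i = sym (cycleMin-unique (i ∸ j) min-y min-x y<M x<M (sym (orbit-cancel j≤i y<M (sym v≡orbit-j-y))))

    longCycleMins shortCycleMins : List ℕ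
    longCycleMins = filter (¬? ∘ shortPeriod?) cycleMins
    shortCycleMins = filter shortPeriod? cycleMins

    longCycleMins-bound : length longCycleMins * L ≤ M
    longCycleMins-bound = subst (_≤ M) (sum-map-const longCycleMins (λ x → length-applyUpTo _ L))
      (disjoint-bounded⇒sum-length≤ M orbitSegment (Unique.filter⁺ _ Unique-cycleMins) unique
        (λ x∈ y∈ → orbitSegments-disjoint (∈-filter⁻ _ x∈ .proj₁) (∈-filter⁻ _ y∈ .proj₁)) bounded)
      where
      unique : ∀ {x} → x ∈ longCycleMins → Unique (orbitSegment x)
      unique x∈ with x∈cycleMins , aperiodic ← ∈-filter⁻ (¬? ∘ shortPeriod?) x∈ =
        Unique-orbitSegment (proj₂ (∈-cycleMins⁻ x∈cycleMins)) aperiodic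
      bounded : ∀ {x v} → x ∈ longCycleMins → v ∈ orbitSegment x → v < M
      bounded {x} _ v∈ with i , _ , refl ← ∈-applyUpTo⁻ _ v∈ = m%n<n (k ^ i * x) M

    module _ (2≤k : 2 ≤ k) where

      private instance
        k≢0 : NonZero k
        k≢0 = >-nonZero (<-trans z<s 2≤k)

      K : ℕ
      K = k ^ L

      shortPeriod : ℕ → ℕ
      shortPeriod x with shortPeriod? x
      ... | yes short = proj₁ (find short)
      ... | no _ = 0

      shortPeriod-spec : ∀ {x} → ShortPeriod x → shortPeriod x < L × 1 ≤ shortPeriod x × orbit (shortPeriod x) x ≡ x
      shortPeriod-spec {x} short with shortPeriod? x
      ... | yes short′ = map₁ ∈-upTo⁻ (proj₂ (find short′))
      ... | no aperiodic = ⊥-elim (aperiodic short)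

      encode : ℕ → ℕ
      encode x = shortPeriod x * K + (k ^ shortPeriod x * x) / M

      quotient<K : ∀ {m x} → m ≤ L → x < M → (k ^ m * x) / M < K
      quotient<K {m} m≤L x<M = <-≤-trans (m<n*o⇒m/o<n (*-monoʳ-< (k ^ m) {{m^n≢0 k m}} x<M)) (^-monoʳ-≤ k m≤L)

      fixed⇒k^m*x≡x+quotient*M : ∀ m x → orbit m x ≡ x → k ^ m * x ≡ x + (k ^ m * x) / M * M
      fixed⇒k^m*x≡x+quotient*M m x fixed = trans (m≡m%n+[m/n]*n (k ^ m * x) M) (cong (_+ (k ^ m * x) / M * M) fixed)

      encode-injective : ∀ {x y} → x ∈ shortCycleMins → y ∈ shortCycleMins → encode x ≡ encode y → x ≡ y
      encode-injective {x} {y} x∈ y∈ encode-x≡encode-y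
        with x∈cycleMins , short-x ← ∈-filter⁻ shortPeriod? x∈ | y∈cycleMins , short-y ← ∈-filter⁻ shortPeriod? y∈
        with m<L , 1≤m , fixed-x ← shortPeriod-spec short-x | m′<L , _ , fixed-y ← shortPeriod-spec short-y
        with _ , x<M ← ∈-cycleMins⁻ x∈cycleMins | _ , y<M ← ∈-cycleMins⁻ y∈cycleMins
        with period-x≡period-y , quotient-x≡quotient-y ← *+-injective K {{m^n≢0 k L}}
             {shortPeriod x} {(k ^ shortPeriod x * x) / M} {shortPeriod y} {(k ^ shortPeriod y * y) / M}
             (quotient<K (<⇒≤ m<L) x<M) (quotient<K (<⇒≤ m′<L) y<M) encode-x≡encode-y
        = a*x≡x+q⇒x-unique (2≤m⇒2≤m^n 2≤k 1≤m)
            (fixed⇒k^m*x≡x+quotient*M (shortPeriod x) x fixed-x)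
            (subst₂ (λ m q → k ^ m * y ≡ y + q * M) (sym period-x≡period-y) (sym quotient-x≡quotient-y)
              (fixed⇒k^m*x≡x+quotient*M (shortPeriod y) y fixed-y))

      shortCycleMins-bound : length shortCycleMins ≤ L * K
      shortCycleMins-bound =
        injection-bounded⇒length≤ (L * K) encode (Unique.filter⁺ _ Unique-cycleMins) encode-injective encode<L*K
        where
        encode<L*K : ∀ {x} → x ∈ shortCycleMins → encode x < L * K
        encode<L*K {x} x∈ with x∈cycleMins , short ← ∈-filter⁻ shortPeriod? x∈ with m<L , _ ← shortPeriod-spec short =
          <-≤-trans (+-monoʳ-< (shortPeriod x * K) (quotient<K (<⇒≤ m<L) (proj₂ (∈-cycleMins⁻ x∈cycleMins))))
                    (≤-trans (≤-reflexive (+-comm (shortPeriod x * K) K)) (*-monoˡ-≤ K m<L))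

      C*L-bound : C k n * L ≤ M + L * K * L
      C*L-bound = ≤-trans
        (≤-reflexive (trans (cong (_* L) (length-filter-split shortPeriod? cycleMins))
                            (*-distribʳ-+ L (length longCycleMins) (length shortCycleMins))))
        (+-mono-≤ longCycleMins-bound (*-monoˡ-≤ L shortCycleMins-bound))

C-bound : ∀ k n L → 2 ≤ k → C k n * L ≤ suc (k * n) + L * k ^ L * L
C-bound k n L = Orbits.C*L-bound k n L

φ≤ : ∀ d → φ d ≤ d
φ≤ d = ≤-trans (length-filter _ (range1 d)) (≤-reflexive (length-range1 d))

∈-divisors⁻ : ∀ {m d} → d ∈ divisors m → d ∣ m × 1 ≤ d
∈-divisors⁻ {m} d∈ with d∈range , d∣m ← ∈-filter⁻ (_∣? m) d∈ = d∣m , proj₁ (∈-range1⁻ {m} d∈range)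

Unique-divisors : ∀ m → Unique (divisors m)
Unique-divisors m = Unique.filter⁺ (_∣? m) (Unique-range1 m)

-- Counting {1, …, m} by gcd with m: a ↦ a · (m / d) maps the units modulo d injectively,
-- and for distinct divisors d the images are disjoint.
module _ (m : ℕ) .{{_ : NonZero m}} where

  cofactor : ℕ → ℕ
  cofactor zero = 0
  cofactor (suc d) = m / suc d

  d*cofactor≡m : ∀ {d} → d ∣ m → 1 ≤ d → d * cofactor d ≡ m
  d*cofactor≡m {suc d} d∣m _ = m*[n/m]≡n d∣m

  totatives : ℕ → List ℕ
  totatives d = filterᵇ (λ a → gcd a d ≡ᵇ 1) (range1 d)

  ∈-totatives⁻ : ∀ {d a} → a ∈ totatives d → Coprime d a × a ≤ d
  ∈-totatives⁻ {d} {a} a∈ with a∈range , gcd≡1 ← ∈-filter⁻ (λ a → T? (gcd a d ≡ᵇ 1)) a∈ =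
    Coprime.sym (gcd≡1⇒coprime (≡ᵇ⇒≡ _ _ gcd≡1)) , proj₂ (∈-range1⁻ {d} a∈range)

  scaledTotatives : ℕ → List ℕ
  scaledTotatives d = map (_* cofactor d) (totatives d)

  scaled-cross : ∀ a a′ {d d′} → d ∣ m → 1 ≤ d → d′ ∣ m → 1 ≤ d′ →
    a * cofactor d ≡ a′ * cofactor d′ → a * d′ ≡ a′ * d
  scaled-cross a a′ {d} {d′} d∣m 1≤d d′∣m 1≤d′ eq = *-cancelʳ-≡ (a * d′) (a′ * d) m (begin
    a * d′ * m                          ≡⟨ cong (a * d′ *_) (d*cofactor≡m d∣m 1≤d) ⟨
    a * d′ * (d * cofactor d)           ≡⟨ rearrange a d′ d (cofactor d) ⟩
    a * cofactor d * (d′ * d)           ≡⟨ cong (_* (d′ * d)) eq ⟩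
    a′ * cofactor d′ * (d′ * d)         ≡⟨ cong (a′ * cofactor d′ *_) (*-comm d′ d) ⟩
    a′ * cofactor d′ * (d * d′)         ≡⟨ rearrange a′ d d′ (cofactor d′) ⟨
    a′ * d * (d′ * cofactor d′)         ≡⟨ cong (a′ * d *_) (d*cofactor≡m d′∣m 1≤d′) ⟩
    a′ * d * m                          ∎)
    where
    open ≡-Reasoning
    rearrange : ∀ a x y c → a * x * (y * c) ≡ a * c * (x * y)
    rearrange = solve-∀

  sum-φ-divisors≤ : sum (map φ (divisors m)) ≤ suc m
  sum-φ-divisors≤ = subst (_≤ suc m) (cong sum (map-cong (λ d → length-map _ (totatives d)) (divisors m)))
    (disjoint-bounded⇒sum-length≤ (suc m) scaledTotatives (Unique-divisors m) unique disjoint bounded)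
    where
    unique : ∀ {d} → d ∈ divisors m → Unique (scaledTotatives d)
    unique {d} d∈ with d∣m , 1≤d ← ∈-divisors⁻ {m} d∈ =
      Unique.map⁺ (λ {a} {b} → *-cancelʳ-≡ a b (cofactor d) {{cofactor≢0}})
        (Unique.filter⁺ (λ a → T? (gcd a d ≡ᵇ 1)) (Unique-range1 d))
      where
      cofactor≢0 : NonZero (cofactor d)
      cofactor≢0 = m*n≢0⇒n≢0 d {{subst NonZero (sym (d*cofactor≡m d∣m 1≤d)) it}}
    disjoint : ∀ {d d′ v} → d ∈ divisors m → d′ ∈ divisors m → v ∈ scaledTotatives d → v ∈ scaledTotatives d′ → d ≡ d′
    disjoint {d} {d′} d∈ d′∈ v∈ v∈′
      with d∣m , 1≤d ← ∈-divisors⁻ {m} d∈ | d′∣m , 1≤d′ ← ∈-divisors⁻ {m} d′∈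
      with a , a∈ , refl ← ∈-map⁻ (_* cofactor d) v∈ | a′ , a′∈ , v≡a′c′ ← ∈-map⁻ (_* cofactor d′) v∈′
      with ad′≡a′d ← scaled-cross a a′ d∣m 1≤d d′∣m 1≤d′ v≡a′c′ =
      ∣-antisym (coprime-divisor (proj₁ (∈-totatives⁻ {d} a∈)) (subst (d ∣_) (sym ad′≡a′d) (n∣m*n a′)))
                (coprime-divisor (proj₁ (∈-totatives⁻ {d′} a′∈)) (subst (d′ ∣_) ad′≡a′d (n∣m*n a)))
    bounded : ∀ {d v} → d ∈ divisors m → v ∈ scaledTotatives d → v < suc m
    bounded {d} d∈ v∈ with d∣m , 1≤d ← ∈-divisors⁻ {m} d∈ with a , a∈ , refl ← ∈-map⁻ (_* cofactor d) v∈ =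
      s≤s (≤-trans (*-monoˡ-≤ (cofactor d) (proj₂ (∈-totatives⁻ {d} a∈))) (≤-reflexive (d*cofactor≡m d∣m 1≤d)))

-- The divisor sum

module _ where

  open import Data.Integer using (+_; +≤+)

  mkℚᵘ*ℕ≤ℕ : ∀ a b c h → a * c ≤ h * suc b → mkℚᵘ (+ a) b *ᵘ ℕ→ℚᵘ c ≤ᵘ ℕ→ℚᵘ h
  mkℚᵘ*ℕ≤ℕ a b c h ac≤h[1+b] = *≤* (subst₂ ℤ._≤_
    (trans (ℤ.pos-* (a * c) 1) (cong (ℤ._* + 1) (ℤ.pos-* a c)))
    (ℤ.pos-* h (suc (b * 1)))
    (+≤+ (subst₂ _≤_ (sym (*-identityʳ (a * c))) (cong (λ z → h * suc z) (sym (*-identityʳ b))) ac≤h[1+b])))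

  ℕ→ℚᵘ-+ : ∀ a b → ℕ→ℚᵘ a +ᵘ ℕ→ℚᵘ b ≃ᵘ ℕ→ℚᵘ (a + b)
  ℕ→ℚᵘ-+ a b = *≡* (begin
    (+ a ℤ.* + 1 ℤ.+ + b ℤ.* + 1) ℤ.* + 1 ≡⟨ ℤ.*-identityʳ _ ⟩
    + a ℤ.* + 1 ℤ.+ + b ℤ.* + 1           ≡⟨ cong₂ ℤ._+_ (ℤ.*-identityʳ (+ a)) (ℤ.*-identityʳ (+ b)) ⟩
    + a ℤ.+ + b                           ≡⟨ ℤ.pos-+ a b ⟨
    + (a + b)                             ≡⟨ ℤ.*-identityʳ _ ⟨
    + (a + b) ℤ.* + 1                     ∎)
    where open ≡-Reasoning

  ℕ→ℚᵘ-mono-≤ : ∀ {a b} → a ≤ b → ℕ→ℚᵘ a ≤ᵘ ℕ→ℚᵘ b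
  ℕ→ℚᵘ-mono-≤ {a} {b} a≤b = *≤* (subst₂ ℤ._≤_ (sym (ℤ.*-identityʳ (+ a))) (sym (ℤ.*-identityʳ (+ b))) (+≤+ a≤b))

termSum : ℕ → List ℕ → ℚᵘ
termSum k = foldr (λ d acc → term k d +ᵘ acc) 0ℚᵘ

termSum*ℓ≤ : ∀ k ℓ (h : ℕ → ℕ) ds → (∀ {d} → d ∈ ds → φ d * ℓ ≤ h d * suc (ord k d ∸ 1)) →
  termSum k ds *ᵘ ℕ→ℚᵘ ℓ ≤ᵘ ℕ→ℚᵘ (sum (map h ds))
termSum*ℓ≤ k ℓ h [] _ = ℚ.≤-reflexive (ℚ.*-zeroˡ (ℕ→ℚᵘ ℓ))
termSum*ℓ≤ k ℓ h (d ∷ ds) bound =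
  ℚ.≤-respˡ-≃ (ℚ.≃-sym (ℚ.*-distribʳ-+ (ℕ→ℚᵘ ℓ) (term k d) (termSum k ds)))
    (ℚ.≤-respʳ-≃ (ℕ→ℚᵘ-+ (h d) (sum (map h ds)))
      (ℚ.+-mono-≤ (mkℚᵘ*ℕ≤ℕ (φ d) (ord k d ∸ 1) ℓ (h d) (bound (here refl)))
                  (termSum*ℓ≤ k ℓ h ds (bound ∘ there))))

module DivisorSum (k n : ℕ) (2≤k : 2 ≤ k) where

  private instance
    k≢0 : NonZero k
    k≢0 = >-nonZero (<-trans z<s 2≤k)

  M : ℕ
  M = suc (k * n)

  k-invertible : ∀ {d} .{{_ : NonZero d}} → d ∈ divisors M → (k * n * n * k) % d ≡ 1 % d
  k-invertible {d} d∈ = [k*n*n]*k≡1-mod-divisor k n d (proj₁ (∈-divisors⁻ {M} d∈))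

  1≤ord : ∀ {d} → d ∈ divisors M → 1 ≤ ord k d
  1≤ord {zero} d∈ with () ← proj₂ (∈-divisors⁻ {M} d∈)
  1≤ord {suc d} d∈ = proj₁ (ord-spec {k} {k * n * n} (k-invertible d∈))

  ord≤L⇒d≤k^L : ∀ {d L} → d ∈ divisors M → ord k d ≤ L → d ≤ k ^ L
  ord≤L⇒d≤k^L {zero} d∈ _ with () ← proj₂ (∈-divisors⁻ {M} d∈)
  ord≤L⇒d≤k^L {suc d} d∈ o≤L with 1≤o , kᵒ≡1 ← ord-spec {k} {k * n * n} (k-invertible d∈) =
    ≤-trans (%≡1⇒≤ {k ^ ord k (suc d)} (2≤m⇒2≤m^n 2≤k 1≤o) kᵒ≡1) (^-monoʳ-≤ k o≤L)

  module _ (c ℓ L : ℕ) (ℓ≤c[1+L] : ℓ ≤ c * suc L) where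

    K : ℕ
    K = k ^ L

    smallOrder : ℕ → Bool
    smallOrder d = ord k d ≤ᵇ L

    -- φ(d)/ord(d) · ℓ ≤ c·φ(d) when ord(d) > L, and ≤ ℓ·K otherwise since then d ≤ K.
    weight : ℕ → ℕ
    weight d = c * φ d + (if smallOrder d then ℓ * K else 0)

    φ*ℓ≤weight*ord : ∀ {d} → d ∈ divisors M → φ d * ℓ ≤ weight d * suc (ord k d ∸ 1)
    φ*ℓ≤weight*ord {d} d∈ rewrite suc-pred (ord k d) {{>-nonZero (1≤ord d∈)}} with smallOrder d in small
    ... | true = begin
      φ d * ℓ                       ≤⟨ *-monoˡ-≤ ℓ (≤-trans (φ≤ d) (ord≤L⇒d≤k^L d∈ (≤ᵇ⇒≤ _ _ (subst T (sym small) _)))) ⟩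
      K * ℓ                         ≡⟨ *-comm K ℓ ⟩
      ℓ * K                         ≤⟨ m≤n+m (ℓ * K) (c * φ d) ⟩
      c * φ d + ℓ * K               ≤⟨ m≤m*n (c * φ d + ℓ * K) (ord k d) {{>-nonZero (1≤ord d∈)}} ⟩
      (c * φ d + ℓ * K) * ord k d   ∎
      where open ≤-Reasoning
    ... | false = begin
      φ d * ℓ                       ≤⟨ *-monoʳ-≤ (φ d) ℓ≤c[1+L] ⟩
      φ d * (c * suc L)             ≤⟨ *-monoʳ-≤ (φ d) (*-monoʳ-≤ c L<ord) ⟩
      φ d * (c * ord k d)           ≡⟨ rearrange (φ d) c (ord k d) ⟩
      (c * φ d + 0) * ord k d       ∎
      where
      open ≤-Reasoning
      L<ord : L < ord k d
      L<ord = ≰⇒> λ o≤L → subst T small (≤⇒≤ᵇ o≤L)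
      rearrange : ∀ f c o → f * (c * o) ≡ (c * f + 0) * o
      rearrange = solve-∀

    smallOrder-count : length (filterᵇ smallOrder (divisors M)) ≤ suc K
    smallOrder-count = Unique-bounded⇒length≤ (suc K) (Unique.filter⁺ (T? ∘ smallOrder) (Unique-divisors M))
      (All.tabulate λ d∈ → let d∈divisors , small = ∈-filter⁻ (T? ∘ smallOrder) d∈ in
        s≤s (ord≤L⇒d≤k^L d∈divisors (≤ᵇ⇒≤ _ _ small)))

    sum-weight≤ : sum (map weight (divisors M)) ≤ c * suc M + ℓ * K * suc K
    sum-weight≤ = begin
      sum (map weight (divisors M))
        ≡⟨ sum-map-+ (λ d → c * φ d) (λ d → if smallOrder d then ℓ * K else 0) (divisors M) ⟩
      sum (map (λ d → c * φ d) (divisors M)) + sum (map (λ d → if smallOrder d then ℓ * K else 0) (divisors M))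
        ≡⟨ cong₂ _+_ (sum-map-*ˡ c φ (divisors M)) (sum-map-if smallOrder (ℓ * K) (divisors M)) ⟩
      c * sum (map φ (divisors M)) + ℓ * K * length (filterᵇ smallOrder (divisors M))
        ≤⟨ +-mono-≤ (*-monoʳ-≤ c (sum-φ-divisors≤ M)) (*-monoʳ-≤ (ℓ * K) smallOrder-count) ⟩
      c * suc M + ℓ * K * suc K ∎
      where open ≤-Reasoning

    divSum*ℓ-bound : divSum k n *ᵘ ℕ→ℚᵘ ℓ ≤ᵘ ℕ→ℚᵘ (c * suc M + ℓ * K * suc K)
    divSum*ℓ-bound = ℚ.≤-trans (termSum*ℓ≤ k ℓ weight (divisors M) φ*ℓ≤weight*ord) (ℕ→ℚᵘ-mono-≤ sum-weight≤)

divSum-bound : ∀ k n c ℓ L → 2 ≤ k → ℓ ≤ c * suc L →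
  divSum k n *ᵘ ℕ→ℚᵘ ℓ ≤ᵘ ℕ→ℚᵘ (c * suc (suc (k * n)) + ℓ * k ^ L * suc (k ^ L))
divSum-bound k n c ℓ L 2≤k = DivisorSum.divSum*ℓ-bound k n 2≤k c ℓ L

-- Choice of the cut-off

module Cutoff (k n : ℕ) (2≤k : 2 ≤ k) (1≤n : 1 ≤ n) where

  private instance
    k≢0 : NonZero k
    k≢0 = >-nonZero (<-trans z<s 2≤k)

  ℓ c : ℕ
  ℓ = ⌊log₂ n ⌋
  c = 3 * k

  private instance
    c≢0 : NonZero c
    c≢0 = m*n≢0 3 k

  L K P : ℕ
  L = ℓ / c
  K = k ^ L
  P = 2 ^ (k * L)

  ℓ≤c*[1+L] : ℓ ≤ c * suc L
  ℓ≤c*[1+L] = begin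
    ℓ                  ≡⟨ m≡m%n+[m/n]*n ℓ c ⟩
    ℓ % c + L * c      ≤⟨ +-monoˡ-≤ (L * c) (<⇒≤ (m%n<n ℓ c)) ⟩
    c + L * c          ≡⟨ *-comm (suc L) c ⟩
    c * suc L          ∎
    where open ≤-Reasoning

  1+L≤P : suc L ≤ P
  1+L≤P = ≤-trans (n<2^n L) (^-monoʳ-≤ 2 (m≤n*m L k))

  K≤P : K ≤ P
  K≤P = ≤-trans (^-monoˡ-≤ L (<⇒≤ (n<2^n k))) (≤-reflexive (^-*-assoc 2 k L))

  P³≤n : P * P * P ≤ n
  P³≤n = begin
    P * P * P          ≡⟨ cube (2 ^ (k * L)) ⟩
    (2 ^ (k * L)) ^ 3  ≡⟨ ^-*-assoc 2 (k * L) 3 ⟩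
    2 ^ (k * L * 3)    ≡⟨ cong (2 ^_) (reorder k L) ⟩
    2 ^ (c * L)        ≤⟨ ^-monoʳ-≤ 2 (≤-trans (≤-reflexive (*-comm c L)) (m/n*n≤m ℓ c)) ⟩
    2 ^ ℓ              ≤⟨ 2^⌊log₂n⌋≤n n 1≤n ⟩
    n                  ∎
    where
    open ≤-Reasoning
    cube : ∀ x → x * x * x ≡ x ^ 3
    cube x = trans (*-assoc x x x) (cong (λ y → x * (x * y)) (sym (*-identityʳ x)))
    reorder : ∀ k L → k * L * 3 ≡ 3 * k * L
    reorder = solve-∀

  L≤P : L ≤ P
  L≤P = ≤-trans (n≤1+n L) 1+L≤P

  C≤kn : C k n ≤ k * n
  C≤kn = ≤-trans (length-filter (T? ∘ isCycleMin k n) (range1 (k * n))) (≤-reflexive (length-range1 (k * n)))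

  rescale : c * (2 * (suc k * n)) ≡ c * (2 * suc k) * n
  rescale = trans (cong (c *_) (sym (*-assoc 2 (suc k) n))) (sym (*-assoc c (2 * suc k) n))

  C*ℓ≤ : C k n * ℓ ≤ c * (2 * suc k) * n
  C*ℓ≤ = begin
    C k n * ℓ                                ≤⟨ *-monoʳ-≤ (C k n) ℓ≤c*[1+L] ⟩
    C k n * (c * suc L)                      ≡⟨ distribute (C k n) c L ⟩
    c * (C k n * L + C k n)                  ≤⟨ *-monoʳ-≤ c (+-mono-≤ (C-bound k n L 2≤k) C≤kn) ⟩
    c * (suc (k * n) + L * K * L + k * n)    ≤⟨ *-monoʳ-≤ c (+-monoˡ-≤ (k * n) (+-monoʳ-≤ (suc (k * n)) LKL≤n)) ⟩
    c * (suc (k * n) + n + k * n)            ≤⟨ *-monoʳ-≤ c (1+kn+n+kn≤2[1+k]n k n 1≤n) ⟩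
    c * (2 * (suc k * n))                    ≡⟨ rescale ⟩
    c * (2 * suc k) * n                      ∎
    where
    open ≤-Reasoning
    LKL≤n : L * K * L ≤ n
    LKL≤n = ≤-trans (*-mono-≤ (*-mono-≤ L≤P K≤P) L≤P) P³≤n
    distribute : ∀ C c L → C * (c * suc L) ≡ c * (C * L + C)
    distribute = solve-∀

  divSum*ℓ≤ : divSum k n *ᵘ ℕ→ℚᵘ ℓ ≤ᵘ ℕ→ℚᵘ (c * (2 * suc k) * n)
  divSum*ℓ≤ = ℚ.≤-trans (divSum-bound k n c ℓ L 2≤k ℓ≤c*[1+L]) (ℕ→ℚᵘ-mono-≤ (begin
    c * suc M + ℓ * K * suc K                 ≤⟨ +-monoʳ-≤ (c * suc M) (*-mono-≤ (*-monoˡ-≤ K ℓ≤c*[1+L]) 1+K≤2*K) ⟩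
    c * suc M + c * suc L * K * (2 * K)       ≡⟨ cong (c * suc M +_) (rearrange c (suc L) K) ⟩
    c * suc M + c * (2 * (suc L * K * K))     ≤⟨ +-monoʳ-≤ (c * suc M) (*-monoʳ-≤ c (*-monoʳ-≤ 2 [1+L]KK≤n)) ⟩
    c * suc M + c * (2 * n)                   ≡⟨ *-distribˡ-+ c (suc M) (2 * n) ⟨
    c * (suc M + 2 * n)                       ≤⟨ *-monoʳ-≤ c (2+kn+2n≤2[1+k]n k n 2≤k 1≤n) ⟩
    c * (2 * (suc k * n))                     ≡⟨ rescale ⟩
    c * (2 * suc k) * n                       ∎))
    where
    open ≤-Reasoning
    M = suc (k * n)
    1+K≤2*K : suc K ≤ 2 * K
    1+K≤2*K = ≤-trans (+-monoˡ-≤ K (m^n>0 k L)) (≤-reflexive (cong (K +_) (sym (+-identityʳ K))))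
    [1+L]KK≤n : suc L * K * K ≤ n
    [1+L]KK≤n = ≤-trans (*-mono-≤ (*-mono-≤ 1+L≤P K≤P) K≤P) P³≤n
    rearrange : ∀ c l K → c * l * K * (2 * K) ≡ c * (2 * (l * K * K))
    rearrange = solve-∀

proposition4p1 : (k : ℕ) → 2 ≤ k →
    Σ ℕ λ c → Σ ℕ λ N → (n : ℕ) → N ≤ n →
    (C k n * ⌊log₂ n ⌋ ≤ c * n)
    × (divSum k n *ᵘ ℕ→ℚᵘ ⌊log₂ n ⌋ ≤ᵘ ℕ→ℚᵘ (c * n))
proposition4p1 k 2≤k = 3 * k * (2 * suc k) , 1 , λ n 1≤n →
  Cutoff.C*ℓ≤ k n 2≤k 1≤n , Cutoff.divSum*ℓ≤ k n 2≤k 1≤n
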